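{- Let $x^{(t)}=(z_1^{(t)},\dots,z_d^{(t)})$, $t\in\mathbb{N}$, be a pseudo-periodic sequence of vectors of floating-point numbers with starting point $N$, period $T$ and growth rates $\alpha_1,\dots,\alpha_d$, and let $P\in\mathbb{Q}[x_1,\dots,x_d]$ be a rational polynomial in $d$ variables. Then $\{t\in\mathbb{N}\mid P(z_1^{(t)},\dots,z_d^{(t)})\ge0\}$ is a semi-linear set.
   Context: Floating-point numbers with precision $p$ (base 10) are $\pm m\cdot10^\alpha$ with $\alpha\in\mathbb{Z}$ and $m\in\{0\}\cup[0.1,1)$ a decimal with $p$ digits after the decimal point. A sequence $(x^{(t)})_{t\in\mathbb{N}}$ of $d$-dimensional vectors of floating-point numbers is pseudo-periodic with starting point $N\in\mathbb{N}$, period $T\ge1$ and growth rates $\alpha_1,\dots,\alpha_d\in\mathbb{Z}$ if $(x^{(t+T)})_j=10^{\alpha_j}(x^{(t)})_j$ for all $t\ge N$ and $j\in\{1,\dots,d\}$. A set $X\subseteq\mathbb{N}$ is semi-linear if there are a finite $F\subseteq\mathbb{N}$ and integers $m,q,b_1,\dots,b_m\in\mathbb{N}$ such that $t\in X$ iff $t\in F$ or $t=b_i+kq$ for some $k\in\mathbb{N}$, $i\in\{1,\dots,m\}$. -}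

module Defs where

open import Data.Nat as ℕ using (ℕ; zero; suc; _∸_; _≥_)
open import Data.Nat.Properties using (m^n≢0)
open import Data.Integer as ℤ using (ℤ; +_; -[1+_])
open import Data.Rational as ℚ using (ℚ; 0ℚ; 1ℚ; _/_; _*_; _+_; -_)
open import Data.Fin using (Fin; zero; suc)
open import Data.List using (List; []; _∷_)
open import Data.List.Membership.Propositional using (_∈_)
open import Data.Product using (Σ; _×_; _,_; ∃; ∃-syntax)
open import Data.Sum using (_⊎_)
open import Relation.Binary.PropositionalEquality using (_≡_)
open import Function.Bundles using (_⇔_)

pow10 : ℤ → ℚ
pow10 (+ n) = (+ (10 ℕ.^ n)) / 1
pow10 (-[1+ n ]) = (+ 1) / (10 ℕ.^ suc n)
  where instance _ = m^n≢0 10 (suc n)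

mantissa : (p M : ℕ) → ℚ
mantissa p M = (+ M) / (10 ℕ.^ p)
  where instance _ = m^n≢0 10 p

-- q is a floating-point number of precision p (base 10):
-- q = ± m · 10^α with m ∈ {0} ∪ [0.1,1) having p decimal digits,
-- i.e. m = M / 10^p with M = 0 or 10^(p-1) ≤ M < 10^p.
IsFloat : ℕ → ℚ → Set
IsFloat p q =
  q ≡ 0ℚ ⊎
  Σ ℕ λ M → Σ ℤ λ α →
    (10 ℕ.^ (p ∸ 1) ℕ.≤ M) × (M ℕ.< 10 ℕ.^ p) ×
    (q ≡ mantissa p M * pow10 α ⊎ q ≡ - (mantissa p M * pow10 α))

PseudoPeriodic : {d : ℕ} → (ℕ → Fin d → ℚ) → (N T : ℕ) → (Fin d → ℤ) → Set
PseudoPeriodic {d} x N T α =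
  T ≥ 1 × (∀ t → t ≥ N → ∀ (j : Fin d) → x (t ℕ.+ T) j ≡ pow10 (α j) * x t j)

_^ℚ_ : ℚ → ℕ → ℚ
q ^ℚ zero = 1ℚ
q ^ℚ suc n = q * (q ^ℚ n)

prodFin : (n : ℕ) → (Fin n → ℚ) → ℚ
prodFin zero f = 1ℚ
prodFin (suc n) f = f zero * prodFin n (λ i → f (suc i))

-- A polynomial in ℚ[x_1,…,x_d]: a finite list of monomials
-- (coefficient c, exponent vector e) standing for Σ c · ∏_j x_j^(e_j).
Poly : ℕ → Set
Poly d = List (ℚ × (Fin d → ℕ))

eval : {d : ℕ} → Poly d → (Fin d → ℚ) → ℚ
eval [] z = 0ℚ
eval {d} ((c , e) ∷ P) z = c * prodFin d (λ j → z j ^ℚ e j) + eval P z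

SemiLinear : (ℕ → Set) → Set
SemiLinear X =
  Σ (List ℕ) λ F → Σ ℕ λ m → Σ ℕ λ q → Σ (Fin m → ℕ) λ b →
    ∀ t → X t ⇔ (t ∈ F ⊎ ∃[ i ] ∃[ k ] t ≡ b i ℕ.+ k ℕ.* q)

-- For t₀ ≥ N the coordinates along t₀, t₀ + T, t₀ + 2T, … are x(t₀ + kT)ⱼ = 10^(k αⱼ) x(t₀)ⱼ,
-- so P(x(t₀ + kT)) is a Laurent polynomial in y = 10ᵏ whose coefficients depend only on t₀.
-- Multiplying by a large power of y, which does not change the sign, gives an ordinary
-- polynomial in y; as y = 10ᵏ is unbounded, its sign is eventually constant in k.  Taking this
-- for the T residues t₀ = N, …, N + T - 1 at once, membership in the set becomes periodic with
-- period T from some point on, and an eventually periodic decidable set is semi-linear.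
module Submission where

open import Level using (0ℓ)
open import Data.Nat as ℕ using (ℕ; zero; suc; z≤n)
import Data.Nat.Properties as ℕ
open import Data.Nat.DivMod using (_%_; m%n<n; m≡m%n+[m/n]*n; m*n/n≡m; /-monoˡ-≤) renaming (_/_ to _div_)
open import Data.Nat.Coprimality using (1-coprimeTo) renaming (sym to coprime-sym)
open import Data.Integer as ℤ using (ℤ)
import Data.Integer.Properties as ℤ
open import Data.Rational
  using (ℚ; mkℚ; 0ℚ; 1ℚ; _/_; _+_; _*_; -_; _-_; _≤_; _<_; _≤?_; 1/_; *≤*;
         Positive; NonZero; positive; nonNegative)
open import Data.Rational.Properties
open import Data.Rational.Solver using (module +-*-Solver)
open import Algebra.Bundles using (CommutativeRing)
open import Algebra.Properties.CommutativeSemiring.Exp (CommutativeRing.commutativeSemiring +-*-commutativeRing)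
  using (_^_; ^-homo-*; ^-assocʳ; ^-distrib-*)
open import Data.Fin using (Fin; zero; suc)
open import Data.List using (List; []; _∷_; filter; upTo; map; length; lookup)
open import Data.List.Membership.Propositional using (_∈_)
open import Data.List.Membership.Propositional.Properties
  using (∈-filter⁺; ∈-filter⁻; ∈-upTo⁺; ∈-map⁺; ∈-map⁻; ∈-lookup)
import Data.List.Relation.Unary.Any as Any
open import Data.List.Relation.Unary.Any.Properties using (lookup-index)
open import Data.Product using (Σ; _×_; _,_; proj₁; proj₂; ∃-syntax)
open import Data.Sum using (_⊎_; inj₁; inj₂)
open import Data.Empty using (⊥; ⊥-elim)
open import Relation.Nullary using (yes; no)
open import Relation.Unary using (Decidable)
open import Relation.Binary.Definitions using (tri<; tri≈; tri>)
open import Relation.Binary.Structures using (IsEquivalence)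
open import Relation.Binary.PropositionalEquality
  using (_≡_; refl; sym; trans; cong; cong₂; subst; subst₂; module ≡-Reasoning)
open import Function.Bundles using (_⇔_; mk⇔; Equivalence)
open import Function.Properties.Equivalence using (⇔-isEquivalence)
open import Defs

open Equivalence using (to; from)
open IsEquivalence (⇔-isEquivalence {0ℓ}) using (reflexive) renaming (sym to ⇔-sym; trans to ⇔-trans)
open +-*-Solver

Eventually : (ℕ → Set) → Set
Eventually P = Σ ℕ λ K → ∀ k → K ℕ.≤ k → P k

eventually-× : ∀ {P Q : ℕ → Set} → Eventually P → Eventually Q → Eventually (λ k → P k × Q k)
eventually-× (K , p) (L , q) =
  K ℕ.⊔ L , λ k le → p k (ℕ.≤-trans (ℕ.m≤m⊔n K L) le) , q k (ℕ.≤-trans (ℕ.m≤n⊔m K L) le)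

eventually-map : ∀ {P Q : ℕ → Set} → (∀ k → P k → Q k) → Eventually P → Eventually Q
eventually-map f (K , p) = K , λ k le → f k (p k le)

eventually-suc : ∀ {P : ℕ → Set} → Eventually P → Eventually (λ k → P k × P (suc k))
eventually-suc (K , p) = K , λ k le → p k le , p (suc k) (ℕ.m≤n⇒m≤1+n le)

eventually-∀< : ∀ {R : ℕ → ℕ → Set} → (∀ r → Eventually (R r)) →
                ∀ n → Eventually (λ k → ∀ r → r ℕ.< n → R r k)
eventually-∀< R-eventually zero = 0 , λ _ _ _ ()
eventually-∀< {R} R-eventually (suc n) =
  eventually-map extend (eventually-× (eventually-∀< R-eventually n) (R-eventually n))
  where
  extend : ∀ k → (∀ r → r ℕ.< n → R r k) × R n k → ∀ r → r ℕ.< suc n → R r k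
  extend k (below , at) r r<1+n with ℕ.m<1+n⇒m<n∨m≡n r<1+n
  ... | inj₁ r<n = below r r<n
  ... | inj₂ refl = at

+-suc-* : ∀ s k T → s ℕ.+ suc k ℕ.* T ≡ s ℕ.+ k ℕ.* T ℕ.+ T
+-suc-* s k T = trans (cong (s ℕ.+_) (ℕ.+-comm T (k ℕ.* T))) (sym (ℕ.+-assoc s (k ℕ.* T) T))

residue-decomposition : ∀ {N t} T .{{_ : ℕ.NonZero T}} → N ℕ.≤ t →
                        t ≡ N ℕ.+ (t ℕ.∸ N) % T ℕ.+ ((t ℕ.∸ N) div T) ℕ.* T
residue-decomposition {N} {t} T N≤t = begin
  t                                                   ≡⟨ sym (ℕ.m+[n∸m]≡n N≤t) ⟩
  N ℕ.+ (t ℕ.∸ N)                                     ≡⟨ cong (N ℕ.+_) (m≡m%n+[m/n]*n (t ℕ.∸ N) T) ⟩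
  N ℕ.+ ((t ℕ.∸ N) % T ℕ.+ ((t ℕ.∸ N) div T) ℕ.* T)   ≡⟨ sym (ℕ.+-assoc N _ _) ⟩
  N ℕ.+ (t ℕ.∸ N) % T ℕ.+ ((t ℕ.∸ N) div T) ℕ.* T     ∎
  where open ≡-Reasoning

module _ {X : ℕ → Set} {N T : ℕ} (periodic : ∀ t → N ℕ.≤ t → X (t ℕ.+ T) ⇔ X t) where

  periodic-iterate : ∀ s k → N ℕ.≤ s → X (s ℕ.+ k ℕ.* T) ⇔ X s
  periodic-iterate s zero _ = reflexive (cong X (ℕ.+-identityʳ s))
  periodic-iterate s (suc k) N≤s =
    ⇔-trans (reflexive (cong X (+-suc-* s k T)))
      (⇔-trans (periodic (s ℕ.+ k ℕ.* T) (ℕ.≤-trans N≤s (ℕ.m≤m+n s _))) (periodic-iterate s k N≤s))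

  eventuallyPeriodic⇒semiLinear : Decidable X → .{{_ : ℕ.NonZero T}} → SemiLinear X
  eventuallyPeriodic⇒semiLinear X? =
    initial , length residues , T , lookup residues , λ t → mk⇔ (covered t) (sound t)
    where
    initial residues : List ℕ
    initial = filter X? (upTo N)
    residues = filter X? (map (N ℕ.+_) (upTo T))

    covered : ∀ t → X t → t ∈ initial ⊎ ∃[ i ] ∃[ k ] t ≡ lookup residues i ℕ.+ k ℕ.* T
    covered t Xt with t ℕ.<? N
    ... | yes t<N = inj₁ (∈-filter⁺ X? (∈-upTo⁺ t<N) Xt)
    ... | no t≮N = inj₂ (Any.index r∈ , q , trans t≡ (cong (ℕ._+ q ℕ.* T) (lookup-index r∈)))
      where
      r = (t ℕ.∸ N) % T
      q = (t ℕ.∸ N) div T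
      t≡ : t ≡ N ℕ.+ r ℕ.+ q ℕ.* T
      t≡ = residue-decomposition T (ℕ.≮⇒≥ t≮N)
      r∈ : N ℕ.+ r ∈ residues
      r∈ = ∈-filter⁺ X? (∈-map⁺ (N ℕ.+_) (∈-upTo⁺ (m%n<n (t ℕ.∸ N) T)))
             (to (periodic-iterate (N ℕ.+ r) q (ℕ.m≤m+n N r)) (subst X t≡ Xt))

    sound : ∀ t → t ∈ initial ⊎ ∃[ i ] ∃[ k ] t ≡ lookup residues i ℕ.+ k ℕ.* T → X t
    sound t (inj₁ t∈) = proj₂ (∈-filter⁻ X? {xs = upTo N} t∈)
    sound t (inj₂ (i , k , refl))
      with ∈-filter⁻ X? {xs = map (N ℕ.+_) (upTo T)} (∈-lookup {xs = residues} i)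
    ... | b∈ , Xb with ∈-map⁻ (N ℕ.+_) b∈
    ... | r , _ , b≡ = from (periodic-iterate _ k (subst (N ℕ.≤_) (sym b≡) (ℕ.m≤m+n N r))) Xb

^ℚ≡^ : ∀ q n → q ^ℚ n ≡ q ^ n
^ℚ≡^ q zero = refl
^ℚ≡^ q (suc n) = cong (q *_) (^ℚ≡^ q n)

1^n≡1 : ∀ n → 1ℚ ^ n ≡ 1ℚ
1^n≡1 zero = refl
1^n≡1 (suc n) = trans (cong (1ℚ *_) (1^n≡1 n)) (*-identityʳ 1ℚ)

module _ {Y W : ℚ} (YW≡1 : Y * W ≡ 1ℚ) where

  ^-inverse : ∀ n → Y ^ n * W ^ n ≡ 1ℚ
  ^-inverse n = trans (sym (^-distrib-* Y W n)) (trans (cong (_^ n) YW≡1) (1^n≡1 n))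

  ^-cancel : ∀ {m n} → n ℕ.≤ m → Y ^ m * W ^ n ≡ Y ^ (m ℕ.∸ n)
  ^-cancel {m} {n} n≤m = begin
    Y ^ m * W ^ n                     ≡⟨ cong (λ k → Y ^ k * W ^ n) (sym (ℕ.m∸n+n≡m n≤m)) ⟩
    Y ^ (m ℕ.∸ n ℕ.+ n) * W ^ n       ≡⟨ cong (_* W ^ n) (^-homo-* Y (m ℕ.∸ n) n) ⟩
    Y ^ (m ℕ.∸ n) * Y ^ n * W ^ n     ≡⟨ *-assoc (Y ^ (m ℕ.∸ n)) (Y ^ n) (W ^ n) ⟩
    Y ^ (m ℕ.∸ n) * (Y ^ n * W ^ n)   ≡⟨ cong (Y ^ (m ℕ.∸ n) *_) (^-inverse n) ⟩
    Y ^ (m ℕ.∸ n) * 1ℚ                ≡⟨ *-identityʳ _ ⟩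
    Y ^ (m ℕ.∸ n)                     ∎
    where open ≡-Reasoning

sumFin : (n : ℕ) → (Fin n → ℕ) → ℕ
sumFin zero f = 0
sumFin (suc n) f = f zero ℕ.+ sumFin n (λ i → f (suc i))

_·_ : {d : ℕ} → (Fin d → ℕ) → (Fin d → ℕ) → ℕ
_·_ {d} u e = sumFin d (λ j → u j ℕ.* e j)

prodFin-cong : ∀ n {f g : Fin n → ℚ} → (∀ i → f i ≡ g i) → prodFin n f ≡ prodFin n g
prodFin-cong zero f≡g = refl
prodFin-cong (suc n) f≡g = cong₂ _*_ (f≡g zero) (prodFin-cong n (λ i → f≡g (suc i)))

prodFin-* : ∀ n (f g : Fin n → ℚ) → prodFin n (λ i → f i * g i) ≡ prodFin n f * prodFin n g
prodFin-* zero f g = sym (*-identityʳ 1ℚ)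
prodFin-* (suc n) f g = trans (cong (f zero * g zero *_) (prodFin-* n _ _))
  (solve 4 (λ a b x y → (a :* b) :* (x :* y) := (a :* x) :* (b :* y)) refl (f zero) (g zero) _ _)

prodFin-^ : ∀ n a (f : Fin n → ℕ) → prodFin n (λ i → a ^ f i) ≡ a ^ sumFin n f
prodFin-^ zero a f = refl
prodFin-^ (suc n) a f = trans (cong (a ^ f zero *_) (prodFin-^ n a _)) (sym (^-homo-* a (f zero) _))

eval-cong : ∀ {d} (P : Poly d) {z z′ : Fin d → ℚ} → (∀ j → z j ≡ z′ j) → eval P z ≡ eval P z′
eval-cong [] z≡z′ = refl
eval-cong {d} ((c , e) ∷ P) z≡z′ =
  cong₂ _+_ (cong (c *_) (prodFin-cong d (λ j → cong (_^ℚ e j) (z≡z′ j)))) (eval-cong P z≡z′)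

monomial-scaling : ∀ {d} Y W (u v e : Fin d → ℕ) (z : Fin d → ℚ) →
  prodFin d (λ j → (Y ^ u j * W ^ v j * z j) ^ℚ e j) ≡
  Y ^ (u · e) * W ^ (v · e) * prodFin d (λ j → z j ^ℚ e j)
monomial-scaling {d} Y W u v e z = begin
  prodFin d (λ j → (Y ^ u j * W ^ v j * z j) ^ℚ e j)
    ≡⟨ prodFin-cong d factor ⟩
  prodFin d (λ j → Y ^ (u j ℕ.* e j) * W ^ (v j ℕ.* e j) * z j ^ℚ e j)
    ≡⟨ prodFin-* d _ _ ⟩
  prodFin d (λ j → Y ^ (u j ℕ.* e j) * W ^ (v j ℕ.* e j)) * prodFin d (λ j → z j ^ℚ e j)
    ≡⟨ cong (_* prodFin d (λ j → z j ^ℚ e j))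
         (trans (prodFin-* d _ _) (cong₂ _*_ (prodFin-^ d Y _) (prodFin-^ d W _))) ⟩
  Y ^ (u · e) * W ^ (v · e) * prodFin d (λ j → z j ^ℚ e j) ∎
  where
  open ≡-Reasoning
  factor : ∀ j → (Y ^ u j * W ^ v j * z j) ^ℚ e j ≡ Y ^ (u j ℕ.* e j) * W ^ (v j ℕ.* e j) * z j ^ℚ e j
  factor j = begin
    (Y ^ u j * W ^ v j * z j) ^ℚ e j
      ≡⟨ ^ℚ≡^ _ (e j) ⟩
    (Y ^ u j * W ^ v j * z j) ^ e j
      ≡⟨ ^-distrib-* _ (z j) (e j) ⟩
    (Y ^ u j * W ^ v j) ^ e j * z j ^ e j
      ≡⟨ cong₂ _*_ (^-distrib-* (Y ^ u j) (W ^ v j) (e j)) (sym (^ℚ≡^ (z j) (e j))) ⟩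
    (Y ^ u j) ^ e j * (W ^ v j) ^ e j * z j ^ℚ e j
      ≡⟨ cong (_* z j ^ℚ e j) (cong₂ _*_ (^-assocʳ Y (u j) (e j)) (^-assocʳ W (v j) (e j))) ⟩
    Y ^ (u j ℕ.* e j) * W ^ (v j ℕ.* e j) * z j ^ℚ e j ∎

Monomials : Set
Monomials = List (ℚ × ℕ)

evalMonomials : Monomials → ℚ → ℚ
evalMonomials [] y = 0ℚ
evalMonomials ((a , n) ∷ ms) y = a * y ^ n + evalMonomials ms y

horner : List ℚ → ℚ → ℚ
horner [] y = 0ℚ
horner (c ∷ cs) y = c + y * horner cs y

addMonomial : ℚ → ℕ → List ℚ → List ℚ
addMonomial a zero [] = a ∷ []
addMonomial a zero (c ∷ cs) = a + c ∷ cs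
addMonomial a (suc n) [] = 0ℚ ∷ addMonomial a n []
addMonomial a (suc n) (c ∷ cs) = c ∷ addMonomial a n cs

horner-addMonomial : ∀ a n cs y → horner (addMonomial a n cs) y ≡ a * y ^ n + horner cs y
horner-addMonomial a zero [] y = solve 2 (λ a y → a :+ y :* con 0ℚ := a :* con 1ℚ :+ con 0ℚ) refl a y
horner-addMonomial a zero (c ∷ cs) y =
  solve 4 (λ a c y h → (a :+ c) :+ y :* h := a :* con 1ℚ :+ (c :+ y :* h)) refl a c y (horner cs y)
horner-addMonomial a (suc n) [] y = trans (cong (λ h → 0ℚ + y * h) (horner-addMonomial a n [] y))
  (solve 3 (λ a y p → con 0ℚ :+ y :* (a :* p :+ con 0ℚ) := a :* (y :* p) :+ con 0ℚ) refl a y (y ^ n))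
horner-addMonomial a (suc n) (c ∷ cs) y = trans (cong (λ h → c + y * h) (horner-addMonomial a n cs y))
  (solve 5 (λ a c y p h → c :+ y :* (a :* p :+ h) := a :* (y :* p) :+ (c :+ y :* h))
     refl a c y (y ^ n) (horner cs y))

toHorner : Monomials → List ℚ
toHorner [] = []
toHorner ((a , n) ∷ ms) = addMonomial a n (toHorner ms)

horner-toHorner : ∀ ms y → horner (toHorner ms) y ≡ evalMonomials ms y
horner-toHorner [] y = refl
horner-toHorner ((a , n) ∷ ms) y =
  trans (horner-addMonomial a n (toHorner ms) y) (cong (a * y ^ n +_) (horner-toHorner ms y))

-- With u, v the positive and negative parts of the growth rates, z = x(t), Y = 10ᵏ and W = 10⁻ᵏ,
-- the point (Y^uⱼ W^vⱼ zⱼ)ⱼ is x(t + kT); the factor Y^Q clears the negative powers of Y.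
module _ {d : ℕ} (u v : Fin d → ℕ) (z : Fin d → ℚ) where

  monomial : (Fin d → ℕ) → ℚ
  monomial e = prodFin d (λ j → z j ^ℚ e j)

  negDegree : Poly d → ℕ
  negDegree [] = 0
  negDegree ((c , e) ∷ P) = v · e ℕ.+ negDegree P

  shiftedMonomials : ℕ → Poly d → Monomials
  shiftedMonomials Q [] = []
  shiftedMonomials Q ((c , e) ∷ P) = (c * monomial e , u · e ℕ.+ (Q ℕ.∸ v · e)) ∷ shiftedMonomials Q P

  clear-denominators : ∀ {Y W} → Y * W ≡ 1ℚ → ∀ P Q → negDegree P ℕ.≤ Q →
    Y ^ Q * eval P (λ j → Y ^ u j * W ^ v j * z j) ≡ evalMonomials (shiftedMonomials Q P) Y
  clear-denominators {Y} YW≡1 [] Q _ = *-zeroʳ (Y ^ Q)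
  clear-denominators {Y} {W} YW≡1 ((c , e) ∷ P) Q le = begin
    Y ^ Q * (c * prodFin d (λ j → (Y ^ u j * W ^ v j * z j) ^ℚ e j) + eval P _)
      ≡⟨ cong (λ m → Y ^ Q * (c * m + eval P _)) (monomial-scaling Y W u v e z) ⟩
    Y ^ Q * (c * (Y ^ (u · e) * W ^ (v · e) * monomial e) + eval P _)
      ≡⟨ solve 6 (λ q c a b m r → q :* (c :* (a :* b :* m) :+ r) := c :* m :* (a :* (q :* b)) :+ q :* r)
           refl (Y ^ Q) c (Y ^ (u · e)) (W ^ (v · e)) (monomial e) (eval P _) ⟩
    c * monomial e * (Y ^ (u · e) * (Y ^ Q * W ^ (v · e))) + Y ^ Q * eval P _
      ≡⟨ cong₂ (λ m r → c * monomial e * (Y ^ (u · e) * m) + r)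
           (^-cancel YW≡1 (ℕ.≤-trans (ℕ.m≤m+n (v · e) _) le))
           (clear-denominators YW≡1 P Q (ℕ.≤-trans (ℕ.m≤n+m _ (v · e)) le)) ⟩
    c * monomial e * (Y ^ (u · e) * Y ^ (Q ℕ.∸ v · e)) + evalMonomials (shiftedMonomials Q P) Y
      ≡⟨ cong (λ m → c * monomial e * m + _) (sym (^-homo-* Y (u · e) _)) ⟩
    c * monomial e * Y ^ (u · e ℕ.+ (Q ℕ.∸ v · e)) + evalMonomials (shiftedMonomials Q P) Y ∎
    where open ≡-Reasoning

-- Eventual sign of a polynomial along an unbounded sequence

-- Bounded away from 0 rather than merely positive, so that the bound survives multiplication
-- by the unbounded sequence in affine-above-one.
EventuallyPositive : (ℕ → ℚ) → Set
EventuallyPositive g = Σ ℚ λ ε → 0ℚ < ε × Eventually (λ k → ε ≤ g k)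

data EventualSign (g : ℕ → ℚ) : Set where
  eventually-zero : Eventually (λ k → g k ≡ 0ℚ) → EventualSign g
  eventually-positive : EventuallyPositive g → EventualSign g
  eventually-negative : EventuallyPositive (λ k → - g k) → EventualSign g

constant-eventualSign : ∀ c {g : ℕ → ℚ} → Eventually (λ k → g k ≡ c) → EventualSign g
constant-eventualSign c g≡c with <-cmp c 0ℚ
... | tri< c<0 _ _ = eventually-negative (- c , neg-antimono-< c<0 ,
                       eventually-map (λ _ gk≡c → ≤-reflexive (cong -_ (sym gk≡c))) g≡c)
... | tri≈ _ c≡0 _ = eventually-zero (eventually-map (λ _ gk≡c → trans gk≡c c≡0) g≡c)
... | tri> _ _ c>0 = eventually-positive (c , c>0 , eventually-map (λ _ gk≡c → ≤-reflexive (sym gk≡c)) g≡c)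

module _ {y : ℕ → ℚ} (y≥0 : ∀ k → 0ℚ ≤ y k) (y-unbounded : ∀ B → Eventually (λ k → B ≤ y k)) where

  affine-above-one : ∀ c {e : ℕ → ℚ} → EventuallyPositive e → Eventually (λ k → 1ℚ ≤ c + y k * e k)
  affine-above-one c {e} (ε , ε>0 , ε≤e) = eventually-map bound (eventually-× ε≤e (y-unbounded B))
    where
    open ≤-Reasoning
    instance
      ε-positive : Positive ε
      ε-positive = positive ε>0
      ε-nonZero : NonZero ε
      ε-nonZero = pos⇒nonZero ε
    B : ℚ
    B = (1ℚ - c) * 1/ ε
    c+Bε≡1 : c + B * ε ≡ 1ℚ
    c+Bε≡1 = begin-equality
      c + (1ℚ - c) * 1/ ε * ε  ≡⟨ cong (c +_) (*-assoc (1ℚ - c) _ ε) ⟩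
      c + (1ℚ - c) * (1/ ε * ε) ≡⟨ cong (λ u → c + (1ℚ - c) * u) (*-inverseˡ ε) ⟩
      c + (1ℚ - c) * 1ℚ ≡⟨ solve 1 (λ c → c :+ (con 1ℚ :- c) :* con 1ℚ := con 1ℚ) refl c ⟩
      1ℚ ∎
    bound : ∀ k → ε ≤ e k × B ≤ y k → 1ℚ ≤ c + y k * e k
    bound k (ε≤ek , B≤yk) = begin
      1ℚ            ≡⟨ sym c+Bε≡1 ⟩
      c + B * ε     ≤⟨ +-monoʳ-≤ c (*-monoʳ-≤-nonNeg ε {{pos⇒nonNeg ε}} B≤yk) ⟩
      c + y k * ε   ≤⟨ +-monoʳ-≤ c (*-monoˡ-≤-nonNeg (y k) {{nonNegative (y≥0 k)}} ε≤ek) ⟩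
      c + y k * e k ∎

  affine-eventualSign : ∀ c {e : ℕ → ℚ} → EventualSign e → EventualSign (λ k → c + y k * e k)
  affine-eventualSign c {e} (eventually-zero e≡0) = constant-eventualSign c (eventually-map affine-at-zero e≡0)
    where
    affine-at-zero : ∀ k → e k ≡ 0ℚ → c + y k * e k ≡ c
    affine-at-zero k ek≡0 =
      trans (cong (λ u → c + y k * u) ek≡0) (solve 2 (λ c y → c :+ y :* con 0ℚ := c) refl c (y k))
  affine-eventualSign c (eventually-positive e-above) =
    eventually-positive (1ℚ , positive⁻¹ 1ℚ , affine-above-one c e-above)
  affine-eventualSign c {e} (eventually-negative e-below) =
    eventually-negative (1ℚ , positive⁻¹ 1ℚ ,
      eventually-map (λ k → subst (1ℚ ≤_) (negated k)) (affine-above-one (- c) e-below))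
    where
    negated : ∀ k → - c + y k * - e k ≡ - (c + y k * e k)
    negated k = solve 3 (λ c y e → :- c :+ y :* (:- e) := :- (c :+ y :* e)) refl c (y k) (e k)

  horner-eventualSign : ∀ cs → EventualSign (λ k → horner cs (y k))
  horner-eventualSign [] = eventually-zero (0 , λ _ _ → refl)
  horner-eventualSign (c ∷ cs) = affine-eventualSign c (horner-eventualSign cs)

eventualSign⇒signStable : ∀ {g} → EventualSign g → Eventually (λ k → (0ℚ ≤ g k) ⇔ (0ℚ ≤ g (suc k)))
eventualSign⇒signStable (eventually-zero g≡0) = eventually-map
  (λ k (gk≡0 , gk+1≡0) → mk⇔ (λ _ → ≤-reflexive (sym gk+1≡0)) (λ _ → ≤-reflexive (sym gk≡0)))
  (eventually-suc g≡0)
eventualSign⇒signStable (eventually-positive (ε , ε>0 , above)) = eventually-map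
  (λ k (ε≤gk , ε≤gk+1) → mk⇔ (λ _ → ≤-trans (<⇒≤ ε>0) ε≤gk+1)
                             (λ _ → ≤-trans (<⇒≤ ε>0) ε≤gk))
  (eventually-suc above)
eventualSign⇒signStable {g} (eventually-negative (ε , ε>0 , below)) = eventually-map
  (λ k (ε≤-gk , ε≤-gk+1) → mk⇔ (λ 0≤gk → ⊥-elim (not-nonNeg k ε≤-gk 0≤gk))
                               (λ 0≤gk+1 → ⊥-elim (not-nonNeg (suc k) ε≤-gk+1 0≤gk+1)))
  (eventually-suc below)
  where
  not-nonNeg : ∀ k → ε ≤ - g k → 0ℚ ≤ g k → ⊥
  not-nonNeg k ε≤-g 0≤g = <-irrefl refl (<-≤-trans ε>0 (≤-trans ε≤-g (neg-antimono-≤ 0≤g)))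

ten tenth : ℚ
ten = ℤ.+ 10 / 1
tenth = ℤ.+ 1 / 10

ten*tenth≡1 : ten * tenth ≡ 1ℚ
ten*tenth≡1 = refl

n/1≡mkℚ : ∀ n → ℤ.+ n / 1 ≡ mkℚ (ℤ.+ n) 0 (coprime-sym (1-coprimeTo n))
n/1≡mkℚ n = normalize-coprime (coprime-sym (1-coprimeTo n))

1/n≡mkℚ : ∀ n → ℤ.+ 1 / suc n ≡ mkℚ (ℤ.+ 1) n (1-coprimeTo (suc n))
1/n≡mkℚ n = normalize-coprime (1-coprimeTo (suc n))

/1-homo-* : ∀ m n → ℤ.+ (m ℕ.* n) / 1 ≡ (ℤ.+ m / 1) * (ℤ.+ n / 1)
/1-homo-* m n = trans (cong (_/ 1) (ℤ.pos-* m n)) (sym (cong₂ _*_ (n/1≡mkℚ m) (n/1≡mkℚ n)))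

1/-homo-* : ∀ m n .{{_ : ℕ.NonZero m}} .{{_ : ℕ.NonZero n}} →
            (ℤ.+ 1 / (m ℕ.* n)) {{ℕ.m*n≢0 m n}} ≡ (ℤ.+ 1 / m) * (ℤ.+ 1 / n)
1/-homo-* (suc m) (suc n) = sym (cong₂ _*_ (1/n≡mkℚ m) (1/n≡mkℚ n))

/1-mono-≤ : ∀ {m n} → m ℕ.≤ n → ℤ.+ m / 1 ≤ ℤ.+ n / 1
/1-mono-≤ {m} {n} m≤n rewrite n/1≡mkℚ m | n/1≡mkℚ n =
  *≤* (subst₂ ℤ._≤_ (sym (ℤ.*-identityʳ (ℤ.+ m))) (sym (ℤ.*-identityʳ (ℤ.+ n))) (ℤ.+≤+ m≤n))

pow10-+ : ∀ n → pow10 (ℤ.+ n) ≡ ten ^ n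
pow10-+ zero = refl
pow10-+ (suc n) = trans (/1-homo-* 10 (10 ℕ.^ n)) (cong (ten *_) (pow10-+ n))

pow10-- : ∀ n → pow10 (ℤ.-[1+ n ]) ≡ tenth ^ suc n
pow10-- zero = refl
pow10-- (suc n) =
  trans (1/-homo-* 10 (10 ℕ.^ suc n) {{_}} {{ℕ.m^n≢0 10 (suc n)}}) (cong (tenth *_) (pow10-- n))

positivePart negativePart : ℤ → ℕ
positivePart (ℤ.+ n) = n
positivePart ℤ.-[1+ n ] = 0
negativePart (ℤ.+ n) = 0
negativePart ℤ.-[1+ n ] = suc n

pow10-split : ∀ a → pow10 a ≡ ten ^ positivePart a * tenth ^ negativePart a
pow10-split (ℤ.+ n) = trans (pow10-+ n) (sym (*-identityʳ _))
pow10-split ℤ.-[1+ n ] = trans (pow10-- n) (sym (*-identityˡ _))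

^-comm : ∀ a m n → (a ^ m) ^ n ≡ (a ^ n) ^ m
^-comm a m n = trans (^-assocʳ a m n) (trans (cong (a ^_) (ℕ.*-comm m n)) (sym (^-assocʳ a n m)))

pow10-^ : ∀ a k → pow10 a ^ k ≡ (ten ^ k) ^ positivePart a * (tenth ^ k) ^ negativePart a
pow10-^ a k = begin
  pow10 a ^ k
    ≡⟨ cong (_^ k) (pow10-split a) ⟩
  (ten ^ positivePart a * tenth ^ negativePart a) ^ k
    ≡⟨ ^-distrib-* _ _ k ⟩
  (ten ^ positivePart a) ^ k * (tenth ^ negativePart a) ^ k
    ≡⟨ cong₂ _*_ (^-comm ten (positivePart a) k) (^-comm tenth (negativePart a) k) ⟩
  (ten ^ k) ^ positivePart a * (tenth ^ k) ^ negativePart a ∎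
  where open ≡-Reasoning

^-positive : ∀ a .{{_ : Positive a}} n → Positive (a ^ n)
^-positive a zero = _
^-positive a (suc n) = pos*pos⇒pos a (a ^ n) {{^-positive a n}}

archimedean : ∀ p → Σ ℕ λ n → p ≤ ℤ.+ n / 1
archimedean p@(mkℚ (ℤ.+ n) d _) = n , subst (p ≤_) (sym (n/1≡mkℚ n))
  (*≤* (subst₂ ℤ._≤_ (sym (ℤ.*-identityʳ (ℤ.+ n))) (ℤ.pos-* n (suc d))
          (ℤ.+≤+ (ℕ.m≤m*n n (suc d)))))
archimedean p@(mkℚ ℤ.-[1+ n ] d _) = 0 , subst (p ≤_) (sym (n/1≡mkℚ 0))
  (*≤* (subst (ℤ._≤ ℤ.+ 0) (sym (ℤ.*-identityʳ ℤ.-[1+ n ])) ℤ.-≤+))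

n≤10^n : ∀ n → n ℕ.≤ 10 ℕ.^ n
n≤10^n zero = z≤n
n≤10^n (suc n) = ℕ.≤-trans (ℕ.+-mono-≤ (ℕ.m^n>0 10 n) (n≤10^n n))
                   (ℕ.+-monoʳ-≤ (10 ℕ.^ n) (ℕ.m≤m+n (10 ℕ.^ n) _))

ten^-unbounded : ∀ B → Eventually (λ k → B ≤ ten ^ k)
ten^-unbounded B with archimedean B
... | n , B≤n = n , λ k n≤k → ≤-trans B≤n (subst (ℤ.+ n / 1 ≤_) (pow10-+ k)
                  (/1-mono-≤ (ℕ.≤-trans (n≤10^n n) (ℕ.^-monoʳ-≤ 10 n≤k))))

-- Sign of a polynomial along a pseudo-periodic sequence

nonNeg⇔nonNeg-*ˡ : ∀ r .{{_ : Positive r}} a → (0ℚ ≤ a) ⇔ (0ℚ ≤ r * a)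
nonNeg⇔nonNeg-*ˡ r a = mk⇔
  (λ 0≤a → subst (_≤ r * a) (*-zeroʳ r) (*-monoˡ-≤-nonNeg r {{pos⇒nonNeg r}} 0≤a))
  (λ 0≤ra → *-cancelˡ-≤-pos r (subst (_≤ r * a) (sym (*-zeroʳ r)) 0≤ra))

module _ {d : ℕ} {x : ℕ → Fin d → ℚ} {N T : ℕ} {α : Fin d → ℤ}
         (pseudoPeriodic : ∀ t → t ℕ.≥ N → ∀ j → x (t ℕ.+ T) j ≡ pow10 (α j) * x t j) where

  pseudoPeriodic-iterate : ∀ t k → N ℕ.≤ t → ∀ j → x (t ℕ.+ k ℕ.* T) j ≡ pow10 (α j) ^ k * x t j
  pseudoPeriodic-iterate t zero _ j = trans (cong (λ s → x s j) (ℕ.+-identityʳ t)) (sym (*-identityˡ _))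
  pseudoPeriodic-iterate t (suc k) N≤t j = begin
    x (t ℕ.+ suc k ℕ.* T) j              ≡⟨ cong (λ s → x s j) (+-suc-* t k T) ⟩
    x (t ℕ.+ k ℕ.* T ℕ.+ T) j            ≡⟨ pseudoPeriodic _ (ℕ.≤-trans N≤t (ℕ.m≤m+n t _)) j ⟩
    pow10 (α j) * x (t ℕ.+ k ℕ.* T) j    ≡⟨ cong (pow10 (α j) *_) (pseudoPeriodic-iterate t k N≤t j) ⟩
    pow10 (α j) * (pow10 (α j) ^ k * x t j) ≡⟨ sym (*-assoc (pow10 (α j)) (pow10 (α j) ^ k) (x t j)) ⟩
    pow10 (α j) ^ suc k * x t j          ∎
    where open ≡-Reasoning

  module _ (P : Poly d) where

    NonNegAt : ℕ → Set
    NonNegAt t = 0ℚ ≤ eval P (x t)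

    nonNegAt-eventually-stable : ∀ t → N ℕ.≤ t →
      Eventually (λ k → NonNegAt (t ℕ.+ k ℕ.* T) ⇔ NonNegAt (t ℕ.+ suc k ℕ.* T))
    nonNegAt-eventually-stable t N≤t =
      eventually-map (λ k stable → ⇔-trans (sign k) (⇔-trans stable (⇔-sym (sign (suc k)))))
        (eventualSign⇒signStable (horner-eventualSign (λ k → ^-nonNeg k) ten^-unbounded cs))
      where
      u v : Fin d → ℕ
      u j = positivePart (α j)
      v j = negativePart (α j)
      Q = negDegree u v (x t) P
      cs = toHorner (shiftedMonomials u v (x t) Q P)

      ^-nonNeg : ∀ k → 0ℚ ≤ ten ^ k
      ^-nonNeg k = nonNegative⁻¹ (ten ^ k) {{pos⇒nonNeg (ten ^ k) {{^-positive ten k}}}}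

      rescaled : ∀ k → (ten ^ k) ^ Q * eval P (x (t ℕ.+ k ℕ.* T)) ≡ horner cs (ten ^ k)
      rescaled k = begin
        (ten ^ k) ^ Q * eval P (x (t ℕ.+ k ℕ.* T))
          ≡⟨ cong ((ten ^ k) ^ Q *_) (eval-cong P (λ j →
               trans (pseudoPeriodic-iterate t k N≤t j) (cong (_* x t j) (pow10-^ (α j) k)))) ⟩
        (ten ^ k) ^ Q * eval P (λ j → (ten ^ k) ^ u j * (tenth ^ k) ^ v j * x t j)
          ≡⟨ clear-denominators u v (x t) (^-inverse ten*tenth≡1 k) P Q ℕ.≤-refl ⟩
        evalMonomials (shiftedMonomials u v (x t) Q P) (ten ^ k)
          ≡⟨ sym (horner-toHorner (shiftedMonomials u v (x t) Q P) (ten ^ k)) ⟩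
        horner cs (ten ^ k) ∎
        where open ≡-Reasoning

      sign : ∀ k → NonNegAt (t ℕ.+ k ℕ.* T) ⇔ (0ℚ ≤ horner cs (ten ^ k))
      sign k = ⇔-trans (nonNeg⇔nonNeg-*ˡ ((ten ^ k) ^ Q) {{^-positive (ten ^ k) {{^-positive ten k}} Q}} _)
                       (reflexive (cong (0ℚ ≤_) (rescaled k)))

    nonNegAt-eventually-periodic : .{{_ : ℕ.NonZero T}} →
      Σ ℕ λ N₀ → ∀ t → N₀ ℕ.≤ t → NonNegAt (t ℕ.+ T) ⇔ NonNegAt t
    nonNegAt-eventually-periodic = N ℕ.+ K ℕ.* T , periodic
      where
      uniform = eventually-∀< (λ r → nonNegAt-eventually-stable (N ℕ.+ r) (ℕ.m≤m+n N r)) T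
      K = proj₁ uniform

      periodic : ∀ t → N ℕ.+ K ℕ.* T ℕ.≤ t → NonNegAt (t ℕ.+ T) ⇔ NonNegAt t
      periodic t N₀≤t = ⇔-trans (reflexive (cong NonNegAt t+T≡))
                          (⇔-trans (⇔-sym (proj₂ uniform q K≤q r (m%n<n (t ℕ.∸ N) T)))
                                   (reflexive (cong NonNegAt (sym t≡))))
        where
        r = (t ℕ.∸ N) % T
        q = (t ℕ.∸ N) div T
        t≡ : t ≡ N ℕ.+ r ℕ.+ q ℕ.* T
        t≡ = residue-decomposition T (ℕ.≤-trans (ℕ.m≤m+n N _) N₀≤t)
        t+T≡ : t ℕ.+ T ≡ N ℕ.+ r ℕ.+ suc q ℕ.* T
        t+T≡ = trans (cong (ℕ._+ T) t≡) (sym (+-suc-* (N ℕ.+ r) q T))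
        K≤q : K ℕ.≤ q
        K≤q = subst (ℕ._≤ q) (m*n/n≡m K T) (/-monoˡ-≤ T
                (subst (ℕ._≤ t ℕ.∸ N) (ℕ.m+n∸m≡n N (K ℕ.* T)) (ℕ.∸-monoˡ-≤ N N₀≤t)))

lemma9 : (p d : ℕ) (x : ℕ → Fin d → ℚ) (N T : ℕ) (α : Fin d → ℤ) →
         (∀ t j → IsFloat p (x t j)) →
         PseudoPeriodic x N T α →
         (P : Poly d) →
         SemiLinear (λ t → 0ℚ ≤ eval P (x t))
lemma9 p d x N T α _ (T≥1 , pseudoPeriodic) P =
  eventuallyPeriodic⇒semiLinear (proj₂ (nonNegAt-eventually-periodic {x = x} {α = α} pseudoPeriodic P))
    (λ t → 0ℚ ≤? eval P (x t))
  where
  instance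
    T≢0 : ℕ.NonZero T
    T≢0 = ℕ.>-nonZero T≥1
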